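{- Let $X$ be a finite totally ordered alphabet and $U\subseteq X\times X$. Suppose $\mathrm{inv}'_U$ and $\mathrm{maj}'_U$ are equidistributed on every rearrangement class of words over $X$. If $x,y,z\in X$ are pairwise distinct and $(x,y),(y,x),(x,z),(z,x)\in U$, then $\{x,y,z\}\times\{x,y,z\}\subseteq U$.
   Context: Words over $X$: finite sequences $w=x_1\cdots x_m$; a rearrangement class is the set of all words with prescribed numbers of occurrences of each letter. $\mathrm{maj}'_U w=\sum_{i=1}^{m-1}i\,\chi((x_i,x_{i+1})\in U)$, $\mathrm{inv}'_U w=\sum_{1\le i<j\le m}\chi((x_i,x_j)\in U)$, $\chi$ the truth indicator. Equidistributed on a class: for each integer $k$ the numbers of words in the class with statistic value $k$ coincide. -}

module Defs where

open import Data.Nat using (ℕ; zero; suc; _+_; _*_)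
open import Data.Nat.Properties using (_≟_)
open import Data.Bool using (Bool; true; false; if_then_else_)
open import Data.Fin using (Fin)
import Data.Fin.Properties as FinP
open import Data.List using (List; []; _∷_; map; concatMap; filter; length; allFin)
open import Data.Nat.ListAction using (sum)
open import Data.Product using (_×_; _,_)
open import Relation.Nullary.Decidable using (⌊_⌋; does)
open import Relation.Binary.PropositionalEquality using (_≡_)

-- Alphabet X = Fin n (finite, totally ordered by the usual order on Fin n).
-- A relation U ⊆ X × X is given by its (decidable) characteristic function.
Rel₂ : ℕ → Set
Rel₂ n = Fin n → Fin n → Bool

Word : ℕ → Set
Word n = List (Fin n)

χ : Bool → ℕ
χ true  = 1
χ false = 0

majFrom : ∀ {n} → Rel₂ n → ℕ → Word n → ℕ
majFrom U i []            = 0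
majFrom U i (x ∷ [])      = 0
majFrom U i (x ∷ y ∷ w)   = i * χ (U x y) + majFrom U (suc i) (y ∷ w)

maj′ : ∀ {n} → Rel₂ n → Word n → ℕ
maj′ U w = majFrom U 1 w

inv′ : ∀ {n} → Rel₂ n → Word n → ℕ
inv′ U []      = 0
inv′ U (x ∷ w) = sum (map (λ y → χ (U x y)) w) + inv′ U w

occ : ∀ {n} → Fin n → Word n → ℕ
occ a []      = 0
occ a (x ∷ w) = (if ⌊ a FinP.≟ x ⌋ then 1 else 0) + occ a w

wordsOfLength : (n m : ℕ) → List (Word n)
wordsOfLength n zero    = [] ∷ []
wordsOfLength n (suc m) = concatMap (λ x → map (x ∷_) (wordsOfLength n m)) (allFin n)

-- a content (multiplicity of each letter) determines a rearrangement class
Content : ℕ → Set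
Content n = Fin n → ℕ

size : ∀ {n} → Content n → ℕ
size {n} c = sum (map c (allFin n))

hasContent : ∀ {n} → Content n → Word n → Bool
hasContent {n} c w = allB (allFin n)
  where
    allB : List (Fin n) → Bool
    allB []      = true
    allB (a ∷ as) = if ⌊ occ a w ≟ c a ⌋ then allB as else false

-- the rearrangement class R(c), as an explicit (duplicate-free) list
rearrangementClass : ∀ {n} → Content n → List (Word n)
rearrangementClass {n} c = filter (λ w → hasContent c w ≟B true) (wordsOfLength n (size c))
  where
    open import Data.Bool.Properties renaming (_≟_ to _≟B_)

countStat : ∀ {n} → (Word n → ℕ) → Content n → ℕ → ℕ
countStat {n} st c k = length (filter (λ w → st w ≟ k) (rearrangementClass c))

Equidistributed : ∀ {n} → Rel₂ n → Set
Equidistributed {n} U = (c : Content n) (k : ℕ) →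
  countStat (inv′ U) c k ≡ countStat (maj′ U) c k

{-# OPTIONS --safe #-}
-- Equidistribution is inherited by the restriction of U to any subalphabet: a
-- rearrangement class over a subalphabet is also one over X (letters outside it get
-- multiplicity 0), and words over X in that class use only letters of the
-- subalphabet. Restricting to {x, y} and to {x, y, z} leaves finitely many relations
-- on two and three letters, and one rearrangement class in each case rules out the
-- relations in which the conclusion fails.
module Submission where

open import Defs
open import Data.Nat using (ℕ; zero; suc; _+_; _*_)
open import Data.Nat.Properties using (_≟_; +-identityʳ; +-*-semiring; m+n≡0⇒n≡0)
open import Data.Nat.ListAction using (sum)
open import Data.Nat.ListAction.Properties using (sum-++)
open import Data.Bool using (Bool; true; false; if_then_else_)
open import Data.Bool.Properties using (¬-not; ⇔→≡) renaming (_≟_ to _≟ᵇ_)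
open import Data.Fin using (Fin; zero; suc)
open import Data.Fin.Patterns using (0F; 1F; 2F)
open import Data.Fin.Properties using (any?) renaming (_≟_ to _≟ᶠ_)
open import Data.List using (List; []; _∷_; _++_; map; concatMap; filter; length; allFin; tabulate)
open import Data.List.Properties using (map-++; map-∘; map-cong; map-tabulate)
open import Data.List.Membership.Propositional using (_∈_; find)
open import Data.List.Relation.Unary.All using (All; []; _∷_)
open import Data.List.Relation.Unary.All.Properties using (tabulate⁺; tabulate⁻)
open import Data.List.Relation.Unary.Any using (Any; here; there)
open import Data.Vec using (Vec; []; _∷_; lookup)
open import Data.Vec.Relation.Unary.All using ([]; _∷_)
open import Data.Vec.Relation.Unary.Unique.Propositional using (Unique; []; _∷_)
open import Data.Vec.Relation.Unary.Unique.Propositional.Properties using (lookup-injective)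
open import Algebra.Properties.Semiring.Sum +-*-semiring
  using (sum-syntax; sum-cong-≗; sum-replicate-zero; ∑-comm) renaming (sum to ∑)
open import Data.Product using (_×_; _,_; proj₁; proj₂)
open import Data.Sum using (_⊎_; inj₁; inj₂)
open import Function using (_∘_; const; _⇔_; mk⇔; Equivalence)
open import Function.Definitions using (Injective)
open import Relation.Nullary using (yes; no; contradiction)
open import Relation.Nullary.Decidable using (⌊_⌋; does)
open import Relation.Unary using (Decidable)
open import Relation.Binary.PropositionalEquality
  using (_≡_; _≢_; _≗_; refl; sym; trans; cong; cong₂; module ≡-Reasoning)

private
  variable
    A B : Set
    k n : ℕ

sum-map-zero : (f : A → ℕ) → (∀ x → f x ≡ 0) → (xs : List A) → sum (map f xs) ≡ 0
sum-map-zero f f≡0 []       = refl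
sum-map-zero f f≡0 (x ∷ xs) = cong₂ _+_ (f≡0 x) (sum-map-zero f f≡0 xs)

length≡sum-map-filter : {P : A → Set} (P? : Decidable P) (xs : List A) →
  length (filter P? xs) ≡ sum (map (χ ∘ does ∘ P?) xs)
length≡sum-map-filter P? [] = refl
length≡sum-map-filter P? (x ∷ xs) with does (P? x)
... | true  = cong suc (length≡sum-map-filter P? xs)
... | false = length≡sum-map-filter P? xs

sum-map-filter : {P : A → Set} (P? : Decidable P) (f : A → ℕ) (xs : List A) →
  sum (map f (filter P? xs)) ≡ sum (map (λ x → χ (does (P? x)) * f x) xs)
sum-map-filter P? f [] = refl
sum-map-filter P? f (x ∷ xs) with does (P? x)
... | true  = cong₂ _+_ (sym (+-identityʳ (f x))) (sum-map-filter P? f xs)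
... | false = sum-map-filter P? f xs

sum-map-concatMap : (f : B → ℕ) (g : A → List B) (xs : List A) →
  sum (map f (concatMap g xs)) ≡ sum (map (λ x → sum (map f (g x))) xs)
sum-map-concatMap f g []       = refl
sum-map-concatMap f g (x ∷ xs) = begin
  sum (map f (g x ++ concatMap g xs))                         ≡⟨ cong sum (map-++ f (g x) (concatMap g xs)) ⟩
  sum (map f (g x) ++ map f (concatMap g xs))                 ≡⟨ sum-++ (map f (g x)) _ ⟩
  sum (map f (g x)) + sum (map f (concatMap g xs))            ≡⟨ cong (sum (map f (g x)) +_) (sum-map-concatMap f g xs) ⟩
  sum (map f (g x)) + sum (map (λ y → sum (map f (g y))) xs) ∎
  where open ≡-Reasoning

sum-tabulate : (f : Fin n → ℕ) → sum (tabulate f) ≡ ∑[ a < n ] f a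
sum-tabulate {zero}  f = refl
sum-tabulate {suc n} f = cong (f zero +_) (sum-tabulate (λ a → f (suc a)))

sum-map-allFin : (f : Fin n → ℕ) → sum (map f (allFin n)) ≡ ∑[ a < n ] f a
sum-map-allFin f = trans (cong sum (map-tabulate (λ a → a) f)) (sum-tabulate f)

-- Written as the summand of occ, so that occ a (b ∷ w) reduces to δ a b + occ a w.
δ : Fin n → Fin n → ℕ
δ a b = if ⌊ a ≟ᶠ b ⌋ then 1 else 0

δ-refl : (a : Fin n) → δ a a ≡ 1
δ-refl a with a ≟ᶠ a
... | yes _  = refl
... | no a≢a = contradiction refl a≢a

δ-≢ : {a b : Fin n} → a ≢ b → δ a b ≡ 0
δ-≢ {a = a} {b} a≢b with a ≟ᶠ b
... | yes a≡b = contradiction a≡b a≢b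
... | no _    = refl

-- Not definitional: ⌊_⌋ does not compute through Fin's _≟_ at suc.
δ-suc : (a b : Fin n) → δ (suc a) (suc b) ≡ δ a b
δ-suc a b with a ≟ᶠ b
... | yes _ = refl
... | no _  = refl

δ-comm : (a b : Fin n) → δ a b ≡ δ b a
δ-comm a b with a ≟ᶠ b
... | yes refl = sym (δ-refl a)
... | no a≢b   = sym (δ-≢ (a≢b ∘ sym))

δ-injective : {e : Fin k → Fin n} → Injective _≡_ _≡_ e → (i j : Fin k) → δ (e i) (e j) ≡ δ i j
δ-injective {e = e} e-injective i j with i ≟ᶠ j
... | yes refl = δ-refl (e i)
... | no i≢j   = δ-≢ (i≢j ∘ e-injective)

∑-δ : (b : Fin n) (f : Fin n → ℕ) → ∑[ a < n ] (δ a b * f a) ≡ f b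
∑-δ {suc n} zero    f =
  trans (cong₂ _+_ (+-identityʳ (f zero)) (sum-replicate-zero n)) (+-identityʳ (f zero))
∑-δ {suc n} (suc b) f =
  trans (sum-cong-≗ (λ a → cong (_* f (suc a)) (δ-suc a b))) (∑-δ b (λ a → f (suc a)))

occ-∈ : {a : Fin n} {w : Word n} → a ∈ w → occ a w ≢ 0
occ-∈ {a = a} (here refl) rewrite δ-refl a = λ ()
occ-∈ {w = b ∷ _} (there a∈w) = occ-∈ a∈w ∘ m+n≡0⇒n≡0 (δ _ b)

foldIf-true⇔All : {P : A → Set} (P? : Decidable P) (F : List A → Bool) → F [] ≡ true →
  (∀ a as → F (a ∷ as) ≡ (if ⌊ P? a ⌋ then F as else false)) →
  (as : List A) → F as ≡ true ⇔ All P as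
foldIf-true⇔All P? F F[] F∷ [] = mk⇔ (const []) (const F[])
foldIf-true⇔All P? F F[] F∷ (a ∷ as) rewrite F∷ a as with P? a
... | yes pa = mk⇔ (λ h → pa ∷ Equivalence.to IH h) (λ { (_ ∷ pas) → Equivalence.from IH pas })
  where IH = foldIf-true⇔All P? F F[] F∷ as
... | no ¬pa = mk⇔ (λ ()) (λ { (pa ∷ _) → contradiction pa ¬pa })

-- hasContent folds a local function over allFin n; abstracting allFin n exposes
-- that function, and it satisfies the equations required of F by refl.
hasContent-true⇔All : (c : Content n) (w : Word n) →
  hasContent c w ≡ true ⇔ All (λ a → occ a w ≡ c a) (allFin n)
hasContent-true⇔All {n} c w with allFin n | foldIf-true⇔All (λ a → occ a w ≟ c a) _ refl (λ _ _ → refl)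
... | as | fold = fold as

hasContent-true⇔ : (c : Content n) (w : Word n) → hasContent c w ≡ true ⇔ (∀ a → occ a w ≡ c a)
hasContent-true⇔ c w = mk⇔ (tabulate⁻ ∘ to) (from ∘ tabulate⁺)
  where open Equivalence (hasContent-true⇔All c w)

classIndicator : (Word n → ℕ) → Content n → ℕ → Word n → ℕ
classIndicator st c v w = χ (does (hasContent c w ≟ᵇ true)) * χ (does (st w ≟ v))

countStat≡sum : (st : Word n → ℕ) (c : Content n) (v : ℕ) →
  countStat st c v ≡ sum (map (classIndicator st c v) (wordsOfLength n (size c)))
countStat≡sum {n} st c v =
  trans (length≡sum-map-filter value? (filter inClass? W)) (sum-map-filter inClass? (χ ∘ does ∘ value?) W)
  where
  W = wordsOfLength n (size c)
  inClass? = λ w → hasContent c w ≟ᵇ true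
  value? = λ w → st w ≟ v

sum-wordsOfLength-suc : (G : Word n → ℕ) (ℓ : ℕ) →
  sum (map G (wordsOfLength n (suc ℓ))) ≡ ∑[ a < n ] sum (map (G ∘ (a ∷_)) (wordsOfLength n ℓ))
sum-wordsOfLength-suc {n} G ℓ = begin
  sum (map G (wordsOfLength n (suc ℓ)))                        ≡⟨ sum-map-concatMap G _ (allFin n) ⟩
  sum (map (λ a → sum (map G (map (a ∷_) W))) (allFin n))     ≡⟨ cong sum (map-cong (λ a → cong sum (sym (map-∘ W))) (allFin n)) ⟩
  sum (map (λ a → sum (map (G ∘ (a ∷_)) W)) (allFin n))       ≡⟨ sum-map-allFin (λ a → sum (map (G ∘ (a ∷_)) W)) ⟩
  ∑[ a < n ] sum (map (G ∘ (a ∷_)) W)                          ∎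
  where
  open ≡-Reasoning
  W = wordsOfLength n ℓ

OutsideImage : (Fin k → Fin n) → Fin n → Set
OutsideImage e a = ∀ i → e i ≢ a

≗-by-image : (e : Fin k → Fin n) {f g : Fin n → A} → (∀ i → f (e i) ≡ g (e i)) →
  (∀ a → OutsideImage e a → f a ≡ g a) → f ≗ g
≗-by-image e on-image outside a with any? (λ i → e i ≟ᶠ a)
... | yes (i , refl) = on-image i
... | no a∉image     = outside a (λ i eᵢ≡a → a∉image (i , eᵢ≡a))

pushforward : (Fin k → Fin n) → Content k → Content n
pushforward {k} e c a = ∑[ i < k ] (δ (e i) a * c i)

pushforward-outside : {e : Fin k → Fin n} {a : Fin n} (c : Content k) →
  OutsideImage e a → pushforward e c a ≡ 0
pushforward-outside {k} c outside =
  trans (sum-cong-≗ (λ i → cong (_* c i) (δ-≢ (outside i)))) (sum-replicate-zero k)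

occ-map-outside : {e : Fin k → Fin n} {a : Fin n} → OutsideImage e a → (w : Word k) → occ a (map e w) ≡ 0
occ-map-outside outside []      = refl
occ-map-outside outside (j ∷ w) = cong₂ _+_ (δ-≢ (outside j ∘ sym)) (occ-map-outside outside w)

hasContent-pushforward-outside : {e : Fin k → Fin n} (c : Content k) {w : Word n} →
  Any (OutsideImage e) w → hasContent (pushforward e c) w ≡ false
hasContent-pushforward-outside c {w} some-outside = ¬-not λ h →
  let a , a∈w , outside = find some-outside
  in occ-∈ a∈w (trans (Equivalence.to (hasContent-true⇔ _ w) h a) (pushforward-outside c outside))

module _ {e : Fin k → Fin n} (e-injective : Injective _≡_ _≡_ e) where

  pushforward-image : (c : Content k) (j : Fin k) → pushforward e c (e j) ≡ c j
  pushforward-image c j = trans (sum-cong-≗ (λ i → cong (_* c i) (δ-injective e-injective i j))) (∑-δ j c)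

  ∑-image : (g : Fin n → ℕ) → (∀ a → OutsideImage e a → g a ≡ 0) → ∑[ a < n ] g a ≡ ∑[ i < k ] g (e i)
  ∑-image g g-outside = begin
    ∑[ a < n ] g a                              ≡⟨ sum-cong-≗ g≗pushforward ⟩
    ∑[ a < n ] ∑[ i < k ] (δ (e i) a * g (e i)) ≡⟨ ∑-comm (λ a i → δ (e i) a * g (e i)) ⟩
    ∑[ i < k ] ∑[ a < n ] (δ (e i) a * g (e i)) ≡⟨ sum-cong-≗ sift ⟩
    ∑[ i < k ] g (e i)                          ∎
    where
    open ≡-Reasoning
    g≗pushforward : g ≗ pushforward e (g ∘ e)
    g≗pushforward = ≗-by-image e
      (λ i → sym (pushforward-image (g ∘ e) i))
      (λ a outside → trans (g-outside a outside) (sym (pushforward-outside (g ∘ e) outside)))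
    sift : ∀ i → ∑[ a < n ] (δ (e i) a * g (e i)) ≡ g (e i)
    sift i = trans (sum-cong-≗ (λ a → cong (_* g (e i)) (δ-comm (e i) a))) (∑-δ (e i) (const (g (e i))))

  size-pushforward : (c : Content k) → size (pushforward e c) ≡ size c
  size-pushforward c = begin
    size (pushforward e c)           ≡⟨ sum-map-allFin (pushforward e c) ⟩
    ∑[ a < n ] pushforward e c a     ≡⟨ ∑-image (pushforward e c) (λ _ → pushforward-outside c) ⟩
    ∑[ i < k ] pushforward e c (e i) ≡⟨ sum-cong-≗ (pushforward-image c) ⟩
    ∑[ i < k ] c i                   ≡⟨ sum-map-allFin c ⟨
    size c                           ∎
    where open ≡-Reasoning

  occ-map-image : (i : Fin k) (w : Word k) → occ (e i) (map e w) ≡ occ i w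
  occ-map-image i []      = refl
  occ-map-image i (j ∷ w) = cong₂ _+_ (δ-injective e-injective i j) (occ-map-image i w)

  hasContent-pushforward-map : (c : Content k) (w : Word k) →
    hasContent (pushforward e c) (map e w) ≡ hasContent c w
  hasContent-pushforward-map c w = ⇔→≡ (mk⇔ (from′ ∘ restrict ∘ to) (from ∘ extend ∘ to′))
    where
    open Equivalence (hasContent-true⇔ (pushforward e c) (map e w))
    open Equivalence (hasContent-true⇔ c w) renaming (to to to′; from to from′)
    restrict : (∀ a → occ a (map e w) ≡ pushforward e c a) → ∀ i → occ i w ≡ c i
    restrict h i = trans (sym (occ-map-image i w)) (trans (h (e i)) (pushforward-image c i))
    extend : (∀ i → occ i w ≡ c i) → ∀ a → occ a (map e w) ≡ pushforward e c a
    extend h = ≗-by-image e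
      (λ i → trans (occ-map-image i w) (trans (h i) (sym (pushforward-image c i))))
      (λ a outside → trans (occ-map-outside outside w) (sym (pushforward-outside c outside)))

  sum-words-image : (G : Word n → ℕ) → (∀ {w} → Any (OutsideImage e) w → G w ≡ 0) →
    (ℓ : ℕ) → sum (map G (wordsOfLength n ℓ)) ≡ sum (map (G ∘ map e) (wordsOfLength k ℓ))
  sum-words-image G G-outside zero    = refl
  sum-words-image G G-outside (suc ℓ) = begin
    sum (map G (wordsOfLength n (suc ℓ)))                         ≡⟨ sum-wordsOfLength-suc G ℓ ⟩
    ∑[ a < n ] sum (map (G ∘ (a ∷_)) (wordsOfLength n ℓ))         ≡⟨ ∑-image _ first-outside ⟩
    ∑[ i < k ] sum (map (G ∘ (e i ∷_)) (wordsOfLength n ℓ))       ≡⟨ sum-cong-≗ rest ⟩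
    ∑[ i < k ] sum (map (G ∘ map e ∘ (i ∷_)) (wordsOfLength k ℓ)) ≡⟨ sum-wordsOfLength-suc (G ∘ map e) ℓ ⟨
    sum (map (G ∘ map e) (wordsOfLength k (suc ℓ)))               ∎
    where
    open ≡-Reasoning
    first-outside : ∀ a → OutsideImage e a → sum (map (G ∘ (a ∷_)) (wordsOfLength n ℓ)) ≡ 0
    first-outside a outside = sum-map-zero (G ∘ (a ∷_)) (λ _ → G-outside (here outside)) (wordsOfLength n ℓ)
    rest : ∀ i → sum (map (G ∘ (e i ∷_)) (wordsOfLength n ℓ))
               ≡ sum (map (G ∘ map e ∘ (i ∷_)) (wordsOfLength k ℓ))
    rest i = sum-words-image (G ∘ (e i ∷_)) (G-outside ∘ there) ℓ

  countStat-pushforward : (st : Word n → ℕ) (st′ : Word k → ℕ) → (∀ w → st (map e w) ≡ st′ w) →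
    (c : Content k) (v : ℕ) → countStat st (pushforward e c) v ≡ countStat st′ c v
  countStat-pushforward st st′ st∘map≡st′ c v = begin
    countStat st (pushforward e c) v                               ≡⟨ countStat≡sum st (pushforward e c) v ⟩
    sum (map indicator (wordsOfLength n (size (pushforward e c)))) ≡⟨ cong (sum ∘ map indicator ∘ wordsOfLength n) (size-pushforward c) ⟩
    sum (map indicator (wordsOfLength n (size c)))                 ≡⟨ sum-words-image indicator vanishes (size c) ⟩
    sum (map (indicator ∘ map e) (wordsOfLength k (size c)))       ≡⟨ cong sum (map-cong restricts (wordsOfLength k (size c))) ⟩
    sum (map (classIndicator st′ c v) (wordsOfLength k (size c)))  ≡⟨ countStat≡sum st′ c v ⟨
    countStat st′ c v                                              ∎
    where
    open ≡-Reasoning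
    indicator = classIndicator st (pushforward e c) v
    vanishes : ∀ {w} → Any (OutsideImage e) w → indicator w ≡ 0
    vanishes some-outside rewrite hasContent-pushforward-outside c some-outside = refl
    restricts : ∀ w → indicator (map e w) ≡ classIndicator st′ c v w
    restricts w rewrite hasContent-pushforward-map c w | st∘map≡st′ w = refl

IsRestriction : (Fin k → Fin n) → Rel₂ n → Rel₂ k → Set
IsRestriction e U V = ∀ i j → V i j ≡ U (e i) (e j)

module _ {e : Fin k → Fin n} {U : Rel₂ n} {V : Rel₂ k} (restriction : IsRestriction e U V) where

  inv′-map : (w : Word k) → inv′ U (map e w) ≡ inv′ V w
  inv′-map []      = refl
  inv′-map (a ∷ w) = cong₂ _+_ first-letter (inv′-map w)
    where
    first-letter : sum (map (λ b → χ (U (e a) b)) (map e w)) ≡ sum (map (λ b → χ (V a b)) w)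
    first-letter =
      trans (cong sum (sym (map-∘ w))) (cong sum (map-cong (λ b → cong χ (sym (restriction a b))) w))

  majFrom-map : (p : ℕ) (w : Word k) → majFrom U p (map e w) ≡ majFrom V p w
  majFrom-map p []          = refl
  majFrom-map p (a ∷ [])    = refl
  majFrom-map p (a ∷ b ∷ w) =
    cong₂ _+_ (cong (λ t → p * χ t) (sym (restriction a b))) (majFrom-map (suc p) (b ∷ w))

Equidistributed-restriction : {e : Fin k → Fin n} {U : Rel₂ n} {V : Rel₂ k} →
  Injective _≡_ _≡_ e → IsRestriction e U V → Equidistributed U → Equidistributed V
Equidistributed-restriction {e = e} {U} {V} e-injective restriction equidistributed c v = begin
  countStat (inv′ V) c v                 ≡⟨ transfer (inv′ U) (inv′ V) (inv′-map restriction) c v ⟨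
  countStat (inv′ U) (pushforward e c) v ≡⟨ equidistributed (pushforward e c) v ⟩
  countStat (maj′ U) (pushforward e c) v ≡⟨ transfer (maj′ U) (maj′ V) (majFrom-map restriction 1) c v ⟩
  countStat (maj′ V) c v                 ∎
  where
  open ≡-Reasoning
  transfer = countStat-pushforward e-injective

fromMatrix : Vec (Vec Bool k) k → Rel₂ k
fromMatrix M i j = lookup (lookup M i) j

-- With x = 0F and y = 1F: on the class of xxy, inv′ is 2 + [xx] on all three words,
-- while maj′ takes the value 1 on yxx when xx ∉ U.
diagonal-forced : (b b′ : Bool) →
  Equidistributed (fromMatrix ((b ∷ true ∷ []) ∷ (true ∷ b′ ∷ []) ∷ [])) → b ≡ true
diagonal-forced true  _ _               = refl
diagonal-forced false _ equidistributed = contradiction (equidistributed (lookup (2 ∷ 1 ∷ [])) 1) λ ()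

-- With x, y, z = 0F, 1F, 2F: on the class of xyz, inv′ ≥ 2, while maj′ is 1 on xyz
-- when yz ∉ U and on xzy when zy ∉ U.
offDiagonal-forced : (b b′ : Bool) →
  Equidistributed (fromMatrix ((true ∷ true ∷ true ∷ []) ∷ (true ∷ true ∷ b ∷ []) ∷ (true ∷ b′ ∷ true ∷ []) ∷ [])) →
  b ≡ true × b′ ≡ true
offDiagonal-forced true  true  _               = refl , refl
offDiagonal-forced true  false equidistributed = contradiction (equidistributed (const 1) 1) λ ()
offDiagonal-forced false true  equidistributed = contradiction (equidistributed (const 1) 1) λ ()
offDiagonal-forced false false equidistributed = contradiction (equidistributed (const 1) 1) λ ()

module _ {n : ℕ} {U : Rel₂ n} (equidistributed : Equidistributed U) where

  diagonal : {x y : Fin n} → x ≢ y → U x y ≡ true → U y x ≡ true → U x x ≡ true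
  diagonal {x} {y} x≢y xy yx =
    diagonal-forced (U x x) (U y y)
      (Equidistributed-restriction (lookup-injective distinct _ _) restriction equidistributed)
    where
    distinct : Unique (x ∷ y ∷ [])
    distinct = (x≢y ∷ []) ∷ [] ∷ []
    restriction : IsRestriction (lookup (x ∷ y ∷ [])) U _
    restriction 0F 0F = refl
    restriction 0F 1F = sym xy
    restriction 1F 0F = sym yx
    restriction 1F 1F = refl

  offDiagonal : {x y z : Fin n} → x ≢ y → y ≢ z → x ≢ z →
    U x x ≡ true → U x y ≡ true → U x z ≡ true → U y x ≡ true → U y y ≡ true → U z x ≡ true → U z z ≡ true →
    U y z ≡ true × U z y ≡ true
  offDiagonal {x} {y} {z} x≢y y≢z x≢z xx xy xz yx yy zx zz =
    offDiagonal-forced (U y z) (U z y)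
      (Equidistributed-restriction (lookup-injective distinct _ _) restriction equidistributed)
    where
    distinct : Unique (x ∷ y ∷ z ∷ [])
    distinct = (x≢y ∷ x≢z ∷ []) ∷ (y≢z ∷ []) ∷ [] ∷ []
    restriction : IsRestriction (lookup (x ∷ y ∷ z ∷ [])) U _
    restriction 0F 0F = sym xx
    restriction 0F 1F = sym xy
    restriction 0F 2F = sym xz
    restriction 1F 0F = sym yx
    restriction 1F 1F = sym yy
    restriction 1F 2F = refl
    restriction 2F 0F = sym zx
    restriction 2F 1F = refl
    restriction 2F 2F = sym zz

lemma6p3 : ∀ {n : ℕ} (U : Rel₂ n) → Equidistributed U →
    (x y z : Fin n) → x ≢ y → y ≢ z → x ≢ z →
    U x y ≡ true → U y x ≡ true → U x z ≡ true → U z x ≡ true →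
    (a b : Fin n) → (a ≡ x ⊎ a ≡ y ⊎ a ≡ z) → (b ≡ x ⊎ b ≡ y ⊎ b ≡ z) →
    U a b ≡ true
lemma6p3 U equidistributed x y z x≢y y≢z x≢z xy yx xz zx _ b = λ where
    (inj₁ refl)        → row xx xy xz b
    (inj₂ (inj₁ refl)) → row yx yy yz b
    (inj₂ (inj₂ refl)) → row zx zy zz b
  where
  xx = diagonal equidistributed x≢y xy yx
  yy = diagonal equidistributed (x≢y ∘ sym) yx xy
  zz = diagonal equidistributed (x≢z ∘ sym) zx xz
  yz×zy = offDiagonal equidistributed x≢y y≢z x≢z xx xy xz yx yy zx zz
  yz = proj₁ yz×zy
  zy = proj₂ yz×zy
  row : ∀ {a} → U a x ≡ true → U a y ≡ true → U a z ≡ true → ∀ b → b ≡ x ⊎ b ≡ y ⊎ b ≡ z → U a b ≡ true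
  row ax _  _  _ (inj₁ refl)        = ax
  row _  ay _  _ (inj₂ (inj₁ refl)) = ay
  row _  _  az _ (inj₂ (inj₂ refl)) = az
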